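{- Let $n\ge 2$ and let $G_n$ be the graph defined as follows. Its vertex set consists of vertices $a,b,u,v,w,x$, a set $X_1$ of $n$ vertices, a set $X_2$ of $n$ vertices, a set $L$ of $n$ vertices and a set $Y$ of $n$ vertices (all these sets pairwise disjoint). Its edges are: $au$, $uv$, $vw$, $wb$; every vertex of $X_1$ is adjacent to both $a$ and $x$; every vertex of $X_2$ is adjacent to both $x$ and $b$; every vertex of $L$ is adjacent to $a$ only (a pendant vertex at $a$); every vertex of $Y$ is adjacent to $b$ only (a pendant vertex at $b$); there are no other edges. Then for every $\tau\in\{\mathrm{gp}_{\rm o},\mathrm{gp}_{\rm d},\mathrm{gp}_{\rm t}\}$, $$\tau(G_n)=2n\quad\text{and}\quad \tau(G_n-x)=4n.$$
   Context: All graphs are finite and simple. For a graph $G$ and $Z\subseteq V(G)$, two vertices $p,q\in V(G)$ are $Z$-positionable if no shortest $p,q$-path in $G$ has an internal vertex (a vertex other than $p,q$) in $Z$. The set $Z$ is a total general position set if every two vertices of $V(G)$ are $Z$-positionable; an outer general position set if every two vertices of $Z$ are $Z$-positionable and every $p\in Z$, $q\in V(G)\setminus Z$ are $Z$-positionable; a dual general position set if every two vertices of $Z$ are $Z$-positionable and every two vertices of $V(G)\setminus Z$ are $Z$-positionable. $\mathrm{gp}_{\rm t}(G)$, $\mathrm{gp}_{\rm o}(G)$, $\mathrm{gp}_{\rm d}(G)$ denote the maximum cardinalities of a total, outer, and dual general position set of $G$, respectively. $G-x$ is the graph obtained by deleting vertex $x$ and its incident edges. -}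

module Defs where

open import Data.Nat using (ℕ; zero; suc; _+_; _*_; _≤_)
open import Data.Fin using (Fin; zero; suc; splitAt; punchIn)
open import Data.Fin.Subset using (Subset; _∈_; _∉_; ∣_∣)
open import Data.List using (List; []; _∷_)
open import Data.List.Membership.Propositional using () renaming (_∈_ to _∈ˡ_)
open import Data.Sum using (_⊎_; inj₁; inj₂)
open import Data.Product using (Σ; _×_; _,_)
open import Relation.Binary.PropositionalEquality using (_≡_; _≢_)

record Graph : Set₁ where
  field
    N   : ℕ
    Adj : Fin N → Fin N → Set
open Graph public

module _ (G : Graph) where
  data Walk : Fin (N G) → Fin (N G) → Set where
    [_] : (p : Fin (N G)) → Walk p p
    _∷_ : ∀ {p r q} → Adj G p r → Walk r q → Walk p q

  len : ∀ {p q} → Walk p q → ℕ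
  len [ p ] = zero
  len (_ ∷ w) = suc (len w)

  verts : ∀ {p q} → Walk p q → List (Fin (N G))
  verts [ p ] = p ∷ []
  verts (_∷_ {p} _ w) = p ∷ verts w

  -- a shortest p,q-walk (necessarily a path): no p,q-walk is shorter
  IsShortest : ∀ {p q} → Walk p q → Set
  IsShortest {p} {q} w = (w' : Walk p q) → len w ≤ len w'

  Internal : ∀ {p q} → Walk p q → Fin (N G) → Set
  Internal {p} {q} w z = (z ∈ˡ verts w) × (z ≢ p) × (z ≢ q)

  Positionable : Subset (N G) → Fin (N G) → Fin (N G) → Set
  Positionable Z p q =
    (w : Walk p q) → IsShortest w → (z : Fin (N G)) → Internal w z → z ∉ Z

  IsTotalGP : Subset (N G) → Set
  IsTotalGP Z = (p q : Fin (N G)) → Positionable Z p q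

  IsOuterGP : Subset (N G) → Set
  IsOuterGP Z =
    ((p q : Fin (N G)) → p ∈ Z → q ∈ Z → Positionable Z p q) ×
    ((p q : Fin (N G)) → p ∈ Z → q ∉ Z → Positionable Z p q)

  IsDualGP : Subset (N G) → Set
  IsDualGP Z =
    ((p q : Fin (N G)) → p ∈ Z → q ∈ Z → Positionable Z p q) ×
    ((p q : Fin (N G)) → p ∉ Z → q ∉ Z → Positionable Z p q)

data GPKind : Set where
  outer dual total : GPKind

IsGP : GPKind → (G : Graph) → Subset (N G) → Set
IsGP outer G = IsOuterGP G
IsGP dual  G = IsDualGP G
IsGP total G = IsTotalGP G

ParamEq : GPKind → Graph → ℕ → Set
ParamEq τ G k =
  (Σ (Subset (N G)) λ Z → IsGP τ G Z × ∣ Z ∣ ≡ k) ×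
  ((Z : Subset (N G)) → IsGP τ G Z → ∣ Z ∣ ≤ k)

deleteVertex : ∀ {M} → (Fin (suc M) → Fin (suc M) → Set) → Fin (suc M) → Graph
deleteVertex {M} A x = record
  { N = M ; Adj = λ i j → A (punchIn x i) (punchIn x j) }

data Kind (n : ℕ) : Set where
  a b u v w x : Kind n
  X₁ X₂ L Y : Fin n → Kind n

data Edge {n : ℕ} : Kind n → Kind n → Set where
  au : Edge a u
  ua : Edge u a
  uv : Edge u v
  vu : Edge v u
  vw : Edge v w
  wv : Edge w v
  wb : Edge w b
  bw : Edge b w
  aX₁ : ∀ i → Edge a (X₁ i)
  X₁a : ∀ i → Edge (X₁ i) a
  xX₁ : ∀ i → Edge x (X₁ i)
  X₁x : ∀ i → Edge (X₁ i) x
  xX₂ : ∀ i → Edge x (X₂ i)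
  X₂x : ∀ i → Edge (X₂ i) x
  bX₂ : ∀ i → Edge b (X₂ i)
  X₂b : ∀ i → Edge (X₂ i) b
  aL : ∀ i → Edge a (L i)
  La : ∀ i → Edge (L i) a
  bY : ∀ i → Edge b (Y i)
  Yb : ∀ i → Edge (Y i) b

size : ℕ → ℕ
size n = 6 + (n + (n + (n + n)))

kind : (n : ℕ) → Fin (size n) → Kind n
kind n zero = a
kind n (suc zero) = u
kind n (suc (suc zero)) = v
kind n (suc (suc (suc zero))) = w
kind n (suc (suc (suc (suc zero)))) = b
kind n (suc (suc (suc (suc (suc zero))))) = x
kind n (suc (suc (suc (suc (suc (suc i)))))) with splitAt n i
... | inj₁ j = X₁ j
... | inj₂ i₁ with splitAt n i₁
...   | inj₁ j = X₂ j
...   | inj₂ i₂ with splitAt n i₂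
...     | inj₁ j = L j
...     | inj₂ j = Y j

GnAdj : (n : ℕ) → Fin (size n) → Fin (size n) → Set
GnAdj n i j = Edge (kind n i) (kind n j)

G : ℕ → Graph
G n = record { N = size n ; Adj = GnAdj n }

xᵥ : (n : ℕ) → Fin (size n)
xᵥ n = suc (suc (suc (suc (suc zero))))

G-x : ℕ → Graph
G-x n = deleteVertex (GnAdj n) (xᵥ n)

{-# OPTIONS --safe #-}
module Submission where

-- Pendant vertices are never inner vertices of shortest paths, so the 2n pendant
-- vertices L ∪ Y of G_n, and the 4n pendant vertices X₁ ∪ X₂ ∪ L ∪ Y of G_n − x,
-- form total, hence also outer and dual, general position sets.
-- Conversely, a vertex p of an outer general position set Z keeps out of Z every inner
-- vertex of every shortest path starting at p.  So a pendant vertex in Z confines Z to the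
-- pendant vertices; in G_n a vertex of X₁ confines Z to X₁ ∪ {w}, one of X₂ to X₂ ∪ {u},
-- and otherwise Z lies in {a, b} or in {u, v, w, x}.  A dual general position set misses a,
-- which is inner between any two of a vertex of L, a vertex of X₁ and u, two of which lie
-- on the same side of Z; likewise it misses b, and then every inner vertex of a shortest
-- a,b-path.  A path is certified shortest by a 1-Lipschitz potential (the distance from a
-- block of vertices) that grows by the length of the path along it.

open import Defs
open import Data.Bool using (Bool; true; false; T; not; _∧_; _∨_; if_then_else_)
open import Data.Bool.Properties using (T-∧; T-∨; T-≡)
open import Data.Empty using (⊥-elim)
open import Data.Fin using (Fin; zero; suc; _↑ˡ_; _↑ʳ_; splitAt; punchIn)
open import Data.Fin.Properties
  using (any?; splitAt-↑ˡ; splitAt-↑ʳ; splitAt⁻¹-↑ˡ; splitAt⁻¹-↑ʳ; punchInᵢ≢i; punchIn-injective)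
open import Data.Fin.Subset using (Subset; _∈_; _∉_; _⊆_; ∣_∣)
open import Data.Fin.Subset.Properties using (_∈?_; p⊆q⇒∣p∣≤∣q∣)
open import Data.List using (List; []; _∷_; map)
open import Data.List.Membership.Propositional using () renaming (_∈_ to _∈ˡ_)
open import Data.List.Relation.Unary.All as All using (All; []; _∷_)
open import Data.List.Relation.Unary.Any using (here; there)
open import Data.Nat using (ℕ; zero; suc; _+_; _*_; _≤_; _<_; s≤s; z≤n; _≤ᵇ_; _≡ᵇ_)
open import Data.Nat.Properties
  using (module ≤-Reasoning; ≤-refl; ≤-reflexive; ≤-trans; m≤m+n; m≤n⇒m≤1+n; n<1+n; m<n⇒m<1+n; <⇒≱;
         +-suc; +-identityʳ; +-monoˡ-≤; +-monoʳ-≤; *-monoʳ-≤; ≤ᵇ⇒≤; ≡ᵇ⇒≡)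
open import Data.Product using (Σ; ∃; _×_; _,_; proj₁; proj₂)
open import Data.Sum using (_⊎_; inj₁; inj₂)
open import Data.Unit using (tt)
open import Data.Vec using (tabulate)
open import Data.Vec.Properties using (tabulate-cong; lookup∘tabulate; lookup⇒[]=; []=⇒lookup)
open import Function using (_∘_; Equivalence)
open import Relation.Binary.PropositionalEquality
open import Relation.Nullary using (¬_; yes; no)

module _ (Γ : Graph) where

  initVerts : ∀ {p q} → Walk Γ p q → List (Fin (N Γ))
  initVerts [ _ ] = []
  initVerts (_∷_ {p} _ γ) = p ∷ initVerts γ

  inner : ∀ {p q} → Walk Γ p q → List (Fin (N Γ))
  inner [ _ ] = []
  inner (_ ∷ γ) = initVerts γ

  private variable
    p q r z : Fin (N Γ)
    Z : Subset (N Γ)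

  initVerts⊆verts : (γ : Walk Γ p q) → z ∈ˡ initVerts γ → z ∈ˡ verts Γ γ
  initVerts⊆verts (_ ∷ _) (here refl) = here refl
  initVerts⊆verts (_ ∷ γ) (there z∈) = there (initVerts⊆verts γ z∈)

  ∈verts⇒∈initVerts : (γ : Walk Γ p q) → z ∈ˡ verts Γ γ → z ≢ q → z ∈ˡ initVerts γ
  ∈verts⇒∈initVerts [ _ ] (here refl) z≢q = ⊥-elim (z≢q refl)
  ∈verts⇒∈initVerts (_ ∷ _) (here refl) _ = here refl
  ∈verts⇒∈initVerts (_ ∷ γ) (there z∈) z≢q = there (∈verts⇒∈initVerts γ z∈ z≢q)

  internal⇒inner : (γ : Walk Γ p q) → Internal Γ γ z → z ∈ˡ inner γ
  internal⇒inner [ _ ] (here refl , z≢p , _) = ⊥-elim (z≢p refl)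
  internal⇒inner (_ ∷ _) (here refl , z≢p , _) = ⊥-elim (z≢p refl)
  internal⇒inner (_ ∷ γ) (there z∈ , _ , z≢q) = ∈verts⇒∈initVerts γ z∈ z≢q

  split-initVerts : (γ : Walk Γ p q) → z ∈ˡ initVerts γ →
    Σ (Walk Γ p z) λ γ₁ → Σ (Walk Γ z q) λ γ₂ → len Γ γ₁ < len Γ γ × len Γ γ₂ ≤ len Γ γ
  split-initVerts (e ∷ γ) (here refl) = [ _ ] , e ∷ γ , s≤s z≤n , ≤-refl
  split-initVerts (e ∷ γ) (there z∈) with split-initVerts γ z∈
  ... | γ₁ , γ₂ , γ₁<γ , γ₂≤γ = e ∷ γ₁ , γ₂ , s≤s γ₁<γ , m≤n⇒m≤1+n γ₂≤γ

  no-shorter : (γ : Walk Γ p q) → IsShortest Γ γ → (γ' : Walk Γ p q) → ¬ len Γ γ' < len Γ γ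
  no-shorter γ sh γ' γ'<γ = <⇒≱ γ'<γ (sh γ')

  inner⇒internal : (γ : Walk Γ p q) → IsShortest Γ γ → z ∈ˡ inner γ → Internal Γ γ z
  inner⇒internal {p} {q} {z} (e ∷ γ) sh z∈ with split-initVerts γ z∈
  ... | γ₁ , γ₂ , γ₁<γ , γ₂≤γ = there (initVerts⊆verts γ z∈) , z≢p , z≢q
    where
    z≢p : z ≢ p
    z≢p refl = no-shorter (e ∷ γ) sh γ₂ (s≤s γ₂≤γ)
    z≢q : z ≢ q
    z≢q refl = no-shorter (e ∷ γ) sh (e ∷ γ₁) (s≤s γ₁<γ)

  positionable⇒inner∉ : Positionable Γ Z p q → (γ : Walk Γ p q) → IsShortest Γ γ → All (_∉ Z) (inner γ)
  positionable⇒inner∉ pos γ sh = All.tabulate λ z∈ → pos γ sh _ (inner⇒internal γ sh z∈)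

  outer⇒inner∉ : IsOuterGP Γ Z → p ∈ Z → (γ : Walk Γ p q) → IsShortest Γ γ → All (_∉ Z) (inner γ)
  outer⇒inner∉ {Z} {p} {q} (in-in , in-out) p∈Z with q ∈? Z
  ... | yes q∈Z = positionable⇒inner∉ (in-in p q p∈Z q∈Z)
  ... | no q∉Z = positionable⇒inner∉ (in-out p q p∈Z q∉Z)

  SameSide : Subset (N Γ) → Fin (N Γ) → Fin (N Γ) → Set
  SameSide Z p q = (p ∈ Z × q ∈ Z) ⊎ (p ∉ Z × q ∉ Z)

  sameSide? : ∀ Z p q r → SameSide Z p q ⊎ SameSide Z p r ⊎ SameSide Z q r
  sameSide? Z p q r with p ∈? Z | q ∈? Z | r ∈? Z
  ... | yes p∈ | yes q∈ | _     = inj₁ (inj₁ (p∈ , q∈))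
  ... | no p∉  | no q∉  | _     = inj₁ (inj₂ (p∉ , q∉))
  ... | yes p∈ | no q∉  | yes r∈ = inj₂ (inj₁ (inj₁ (p∈ , r∈)))
  ... | no p∉  | yes q∈ | no r∉  = inj₂ (inj₁ (inj₂ (p∉ , r∉)))
  ... | no _   | yes q∈ | yes r∈ = inj₂ (inj₂ (inj₁ (q∈ , r∈)))
  ... | yes _  | no q∉  | no r∉  = inj₂ (inj₂ (inj₂ (q∉ , r∉)))

  dual⇒inner∉ : IsDualGP Γ Z → SameSide Z p q → (γ : Walk Γ p q) → IsShortest Γ γ → All (_∉ Z) (inner γ)
  dual⇒inner∉ (in-in , _) (inj₁ (p∈Z , q∈Z)) = positionable⇒inner∉ (in-in _ _ p∈Z q∈Z)
  dual⇒inner∉ (_ , out-out) (inj₂ (p∉Z , q∉Z)) = positionable⇒inner∉ (out-out _ _ p∉Z q∉Z)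

  Pendant : Fin (N Γ) → Set
  Pendant z = ∀ {p q} → Adj Γ p z → Adj Γ z q → p ≡ q

  shortest-tail : (e : Adj Γ p r) (γ : Walk Γ r q) → IsShortest Γ (e ∷ γ) → IsShortest Γ γ
  shortest-tail e γ sh γ' with sh (e ∷ γ')
  ... | s≤s le = le

  pendant∉inner : Pendant z → (γ : Walk Γ p q) → IsShortest Γ γ → ¬ z ∈ˡ inner γ
  pendant∉inner pz (e ∷ (e′ ∷ γ)) sh (here refl) with pz e e′
  ... | refl = no-shorter (e ∷ (e′ ∷ γ)) sh γ (m<n⇒m<1+n (n<1+n _))
  pendant∉inner pz (e ∷ γ@(_ ∷ _)) sh (there z∈) = pendant∉inner pz γ (shortest-tail e γ sh) z∈

  pendants-total : (∀ {z} → z ∈ Z → Pendant z) → IsTotalGP Γ Z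
  pendants-total pendant p q γ sh z int z∈Z = pendant∉inner (pendant z∈Z) γ sh (internal⇒inner γ int)

  total⇒gp : ∀ τ → IsTotalGP Γ Z → IsGP τ Γ Z
  total⇒gp outer T = (λ p q _ _ → T p q) , (λ p q _ _ → T p q)
  total⇒gp dual  T = (λ p q _ _ → T p q) , (λ p q _ _ → T p q)
  total⇒gp total T = T

  Lipschitz : (Fin (N Γ) → ℕ) → Set
  Lipschitz h = ∀ {p q} → Adj Γ p q → h q ≤ suc (h p)

  lipschitz-bound : ∀ {h} → Lipschitz h → (γ : Walk Γ p q) → h q ≤ len Γ γ + h p
  lipschitz-bound lip [ _ ] = ≤-refl
  lipschitz-bound {h = h} lip (_∷_ {p} e γ) = begin
    _                      ≤⟨ lipschitz-bound lip γ ⟩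
    len Γ γ + _            ≤⟨ +-monoʳ-≤ (len Γ γ) (lip e) ⟩
    len Γ γ + suc (h p)    ≡⟨ +-suc (len Γ γ) (h p) ⟩
    suc (len Γ γ) + h p    ∎
    where open ≤-Reasoning

  shortest-by-potential : ∀ {h} → Lipschitz h → (γ : Walk Γ p q) → h p ≡ 0 → h q ≡ len Γ γ → IsShortest Γ γ
  shortest-by-potential {p} {q} {h} lip γ hp≡0 hq≡len γ' = begin
    len Γ γ        ≡⟨ sym hq≡len ⟩
    h q            ≤⟨ lipschitz-bound lip γ' ⟩
    len Γ γ' + h p ≡⟨ cong (len Γ γ' +_) hp≡0 ⟩
    len Γ γ' + 0   ≡⟨ +-identityʳ _ ⟩
    len Γ γ'       ∎
    where open ≤-Reasoning

within : ∀ {m k} {Z S : Subset m} → Z ⊆ S → ∣ S ∣ ≤ k → ∣ Z ∣ ≤ k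
within Z⊆S ∣S∣≤k = ≤-trans (p⊆q⇒∣p∣≤∣q∣ Z⊆S) ∣S∣≤k

∣tabulate∣-++ : ∀ m {k} (g : Fin (m + k) → Bool) →
  ∣ tabulate g ∣ ≡ ∣ tabulate (g ∘ (_↑ˡ k)) ∣ + ∣ tabulate (g ∘ (m ↑ʳ_)) ∣
∣tabulate∣-++ zero g = refl
∣tabulate∣-++ (suc m) g with g zero
... | true  = cong suc (∣tabulate∣-++ m (g ∘ suc))
... | false = ∣tabulate∣-++ m (g ∘ suc)

∣tabulate∣-const : ∀ m c → ∣ tabulate {n = m} (λ _ → c) ∣ ≡ (if c then m else 0)
∣tabulate∣-const zero true = refl
∣tabulate∣-const zero false = refl
∣tabulate∣-const (suc m) true = cong suc (∣tabulate∣-const m true)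
∣tabulate∣-const (suc m) false = ∣tabulate∣-const m false

module _ {n : ℕ} where

  data Route : Kind n → Kind n → Set where
    []  : ∀ {k} → Route k k
    _∷_ : ∀ {k k′ q} → Edge k k′ → Route k′ q → Route k q

  length : ∀ {k q} → Route k q → ℕ
  length [] = 0
  length (_ ∷ r) = suc (length r)

  allStops : (Kind n → Bool) → ∀ {k q} → Route k q → Bool
  allStops P {k} [] = P k
  allStops P {k} (_ ∷ r) = P k ∧ allStops P r

  byKind : {A : Set} (a′ u′ v′ w′ b′ x′ X₁′ X₂′ L′ Y′ : A) → Kind n → A
  byKind a′ u′ v′ w′ b′ x′ X₁′ X₂′ L′ Y′ = λ where
    a → a′ ; u → u′ ; v → v′ ; w → w′ ; b → b′ ; x → x′
    (X₁ _) → X₁′ ; (X₂ _) → X₂′ ; (L _) → L′ ; (Y _) → Y′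

  EveryEdge : (Kind n → Kind n → Set) → Set
  EveryEdge R =
    R a u × R u a × R u v × R v u × R v w × R w v × R w b × R b w ×
    (∀ i → R a (X₁ i)) × (∀ i → R (X₁ i) a) × (∀ i → R x (X₁ i)) × (∀ i → R (X₁ i) x) ×
    (∀ i → R x (X₂ i)) × (∀ i → R (X₂ i) x) × (∀ i → R b (X₂ i)) × (∀ i → R (X₂ i) b) ×
    (∀ i → R a (L i)) × (∀ i → R (L i) a) × (∀ i → R b (Y i)) × (∀ i → R (Y i) b)

  every-edge : ∀ R → EveryEdge R → ∀ {k k′} → Edge k k′ → R k k′
  every-edge _ (Rau , Rua , Ruv , Rvu , Rvw , Rwv , Rwb , Rbw ,
              RaX₁ , RX₁a , RxX₁ , RX₁x , RxX₂ , RX₂x , RbX₂ , RX₂b , RaL , RLa , RbY , RYb) = λ where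
    au → Rau ; ua → Rua ; uv → Ruv ; vu → Rvu ; vw → Rvw ; wv → Rwv ; wb → Rwb ; bw → Rbw
    (aX₁ i) → RaX₁ i ; (X₁a i) → RX₁a i ; (xX₁ i) → RxX₁ i ; (X₁x i) → RX₁x i
    (xX₂ i) → RxX₂ i ; (X₂x i) → RX₂x i ; (bX₂ i) → RbX₂ i ; (X₂b i) → RX₂b i
    (aL i) → RaL i ; (La i) → RLa i ; (bY i) → RbY i ; (Yb i) → RYb i

  LipschitzOn : (Kind n → Bool) → (Kind n → ℕ) → Set
  LipschitzOn P φ = ∀ {k k′} → T (P k) → T (P k′) → Edge k k′ → φ k′ ≤ suc (φ k)

  -- The inequality comes first, so that the check evaluates to true even where P is unknown.
  LipschitzStep : (Kind n → Bool) → (Kind n → ℕ) → Kind n → Kind n → Set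
  LipschitzStep P φ k k′ = T ((φ k′ ≤ᵇ suc (φ k)) ∨ not (P k ∧ P k′))

  lipschitz : ∀ P φ → EveryEdge (LipschitzStep P φ) → LipschitzOn P φ
  lipschitz P φ check Pk Pk′ e with Equivalence.to T-∨ (every-edge (LipschitzStep P φ) check e)
  ... | inj₁ le = ≤ᵇ⇒≤ _ _ le
  ... | inj₂ absent = ⊥-elim (contradiction (Equivalence.from T-∧ (Pk , Pk′)) absent)
    where
    contradiction : ∀ {c} → T c → ¬ T (not c)
    contradiction {true} _ ()

  -- Distances in G_n from the blocks L, Y, X₁, X₂ (each as a whole) and from a, b.
  distL distY distX₁ distX₂ dista distb : Kind n → ℕ
  distL  = byKind 1 2 3 4 5 3 2 4 0 6
  distY  = byKind 5 4 3 2 1 3 4 2 6 0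
  distX₁ = byKind 1 2 3 4 3 1 0 2 2 4
  distX₂ = byKind 3 4 3 2 1 1 2 0 4 2
  dista  = byKind 0 1 2 3 4 2 1 3 1 5
  distb  = byKind 4 3 2 1 0 2 3 1 5 1

  -- Distances in G_n − x from X₁ ∪ L and from X₂ ∪ Y; the value at the deleted x is arbitrary.
  distLeft distRight : Kind n → ℕ
  distLeft  = byKind 1 2 3 4 5 0 0 6 0 6
  distRight = byKind 5 4 3 2 1 0 6 0 6 0

  isX : Kind n → Bool
  isX x = true
  isX _ = false

  -- The kinds of the vertices of G_n (withX = true) and of G_n − x (withX = false).
  present : Bool → Kind n → Bool
  present withX k = not (isX k) ∨ withX

  present-true : ∀ k → T (present true k)
  present-true k with isX k
  ... | true = tt
  ... | false = tt

  PendantKind : (Kind n → Bool) → Kind n → Set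
  PendantKind P k = ∀ {k₁ k₂} → T (P k₁) → T (P k₂) → Edge k₁ k → Edge k k₂ → k₁ ≡ k₂

  L-pendant : ∀ {P j} → PendantKind P (L j)
  L-pendant _ _ (aL _) (La _) = refl

  Y-pendant : ∀ {P j} → PendantKind P (Y j)
  Y-pendant _ _ (bY _) (Yb _) = refl

  X₁-pendant : ∀ {j} → PendantKind (present false) (X₁ j)
  X₁-pendant _ _ (aX₁ _) (X₁a _) = refl
  X₁-pendant () _ (xX₁ _) _
  X₁-pendant _ () _ (X₁x _)

  X₂-pendant : ∀ {j} → PendantKind (present false) (X₂ j)
  X₂-pendant _ _ (bX₂ _) (X₂b _) = refl
  X₂-pendant () _ (xX₂ _) _
  X₂-pendant _ () _ (X₂x _)

module Indexing (n : ℕ) where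

  index : Kind n → Fin (size n)
  index a = zero
  index u = suc zero
  index v = suc (suc zero)
  index w = suc (suc (suc zero))
  index b = suc (suc (suc (suc zero)))
  index x = suc (suc (suc (suc (suc zero))))
  index (X₁ j) = 6 ↑ʳ (j ↑ˡ (n + (n + n)))
  index (X₂ j) = 6 ↑ʳ (n ↑ʳ (j ↑ˡ (n + n)))
  index (L j)  = 6 ↑ʳ (n ↑ʳ (n ↑ʳ (j ↑ˡ n)))
  index (Y j)  = 6 ↑ʳ (n ↑ʳ (n ↑ʳ (n ↑ʳ j)))

  kind-index : ∀ k → kind n (index k) ≡ k
  kind-index a = refl
  kind-index u = refl
  kind-index v = refl
  kind-index w = refl
  kind-index b = refl
  kind-index x = refl
  kind-index (X₁ j) rewrite splitAt-↑ˡ n j (n + (n + n)) = refl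
  kind-index (X₂ j) rewrite splitAt-↑ʳ n (n + (n + n)) (j ↑ˡ (n + n)) | splitAt-↑ˡ n j (n + n) = refl
  kind-index (L j) rewrite splitAt-↑ʳ n (n + (n + n)) (n ↑ʳ (j ↑ˡ n)) | splitAt-↑ʳ n (n + n) (j ↑ˡ n) | splitAt-↑ˡ n j n = refl
  kind-index (Y j) rewrite splitAt-↑ʳ n (n + (n + n)) (n ↑ʳ (n ↑ʳ j)) | splitAt-↑ʳ n (n + n) (n ↑ʳ j) | splitAt-↑ʳ n n j = refl

  index-kind : ∀ i → index (kind n i) ≡ i
  index-kind zero = refl
  index-kind (suc zero) = refl
  index-kind (suc (suc zero)) = refl
  index-kind (suc (suc (suc zero))) = refl
  index-kind (suc (suc (suc (suc zero)))) = refl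
  index-kind (suc (suc (suc (suc (suc zero))))) = refl
  index-kind (suc (suc (suc (suc (suc (suc i)))))) with splitAt n i in eq₁
  ... | inj₁ j = cong (6 ↑ʳ_) (splitAt⁻¹-↑ˡ eq₁)
  ... | inj₂ i₁ with splitAt n i₁ in eq₂
  ...   | inj₁ j = cong (6 ↑ʳ_) (trans (cong (n ↑ʳ_) (splitAt⁻¹-↑ˡ eq₂)) (splitAt⁻¹-↑ʳ eq₁))
  ...   | inj₂ i₂ with splitAt n i₂ in eq₃
  ...     | inj₁ j = cong (6 ↑ʳ_) (trans (cong (n ↑ʳ_) (trans (cong (n ↑ʳ_) (splitAt⁻¹-↑ˡ eq₃)) (splitAt⁻¹-↑ʳ eq₂))) (splitAt⁻¹-↑ʳ eq₁))
  ...     | inj₂ j = cong (6 ↑ʳ_) (trans (cong (n ↑ʳ_) (trans (cong (n ↑ʳ_) (splitAt⁻¹-↑ʳ eq₃)) (splitAt⁻¹-↑ʳ eq₂))) (splitAt⁻¹-↑ʳ eq₁))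

  ∣block∣ : (f : Kind n → Bool) (B : Fin n → Kind n) {c : Bool} → (∀ j → f (B j) ≡ c) →
    ∣ tabulate (f ∘ kind n ∘ index ∘ B) ∣ ≡ (if c then n else 0)
  ∣block∣ f B fB≡c = trans (cong ∣_∣ (tabulate-cong λ j → trans (cong f (kind-index (B j))) (fB≡c j))) (∣tabulate∣-const n _)

  -- kindSet f with the hub entries stripped off, both in G_n and in G_n − x.
  ∣blocks∣ : (f : Kind n → Bool) {c₁ c₂ c₃ c₄ : Bool} →
    (∀ j → f (X₁ j) ≡ c₁) → (∀ j → f (X₂ j) ≡ c₂) → (∀ j → f (L j) ≡ c₃) → (∀ j → f (Y j) ≡ c₄) →
    ∣ tabulate (f ∘ kind n ∘ (6 ↑ʳ_)) ∣ ≡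
      (if c₁ then n else 0) + ((if c₂ then n else 0) + ((if c₃ then n else 0) + (if c₄ then n else 0)))
  ∣blocks∣ f h₁ h₂ h₃ h₄ = begin
    ∣ tabulate (f ∘ kind n ∘ (6 ↑ʳ_)) ∣
      ≡⟨ ∣tabulate∣-++ n _ ⟩
    count X₁ + ∣ tabulate (f ∘ kind n ∘ (6 ↑ʳ_) ∘ (n ↑ʳ_)) ∣
      ≡⟨ cong (count X₁ +_) (∣tabulate∣-++ n _) ⟩
    count X₁ + (count X₂ + ∣ tabulate (f ∘ kind n ∘ (6 ↑ʳ_) ∘ (n ↑ʳ_) ∘ (n ↑ʳ_)) ∣)
      ≡⟨ cong (λ t → count X₁ + (count X₂ + t)) (∣tabulate∣-++ n _) ⟩
    count X₁ + (count X₂ + (count L + count Y))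
      ≡⟨ cong₂ _+_ (∣block∣ f X₁ h₁) (cong₂ _+_ (∣block∣ f X₂ h₂) (cong₂ _+_ (∣block∣ f L h₃) (∣block∣ f Y h₄))) ⟩
    _ ∎
    where
    open ≡-Reasoning
    count : (Fin n → Kind n) → ℕ
    count B = ∣ tabulate (f ∘ kind n ∘ index ∘ B) ∣

module Labelled {n : ℕ} (o : Fin n) (withX : Bool) {M : ℕ}
  (label : Fin M → Kind n) (index : Kind n → Fin M)
  (label-present : ∀ i → T (present withX (label i)))
  (label-index : ∀ k → T (present withX k) → label (index k) ≡ k)
  (index-label : ∀ i → index (label i) ≡ i) where

  Γ : Graph
  Γ = record { N = M ; Adj = λ i j → Edge (label i) (label j) }

  private variable
    k q : Kind n
    Z : Subset M

  Present : Kind n → Set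
  Present k = T (present withX k)

  RoutePresent : Route k q → Set
  RoutePresent r = T (allStops (present withX) r)

  first-present : (r : Route k q) → RoutePresent r → Present k
  first-present [] ok = ok
  first-present (_ ∷ _) ok = proj₁ (Equivalence.to T-∧ ok)

  last-present : (r : Route k q) → RoutePresent r → Present q
  last-present [] ok = ok
  last-present (_ ∷ r) ok = last-present r (proj₂ (Equivalence.to T-∧ ok))

  walk : (r : Route k q) → {RoutePresent r} → Walk Γ (index k) (index q)
  walk [] = [ _ ]
  walk {k} (_∷_ {k′ = k′} e r) {ok} =
    let pk , ok′ = Equivalence.to T-∧ ok
    in subst₂ Edge (sym (label-index k pk)) (sym (label-index k′ (first-present r ok′))) e ∷ walk r {ok′}

  len-walk : (r : Route k q) {ok : RoutePresent r} → len Γ (walk r {ok}) ≡ length r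
  len-walk [] = refl
  len-walk (_ ∷ r) = cong suc (len-walk r)

  -- For concrete φ and r the implicit certificates are found by evaluation.
  shortest : (φ : Kind n → ℕ) {lip : EveryEdge (LipschitzStep (present withX) φ)}
    (r : Route k q) {ok : RoutePresent r} {tight : T ((φ k ≡ᵇ 0) ∧ (φ q ≡ᵇ length r))} →
    IsShortest Γ (walk r {ok})
  shortest {k} {q} φ {lip} r {ok} {tight} =
    shortest-by-potential Γ lip′ (walk r) φk≡0 φq≡len
    where
    lip′ : Lipschitz Γ (φ ∘ label)
    lip′ {i} {j} = lipschitz (present withX) φ lip (label-present i) (label-present j)
    φk≡0 : φ (label (index k)) ≡ 0
    φk≡0 = trans (cong φ (label-index k (first-present r ok))) (≡ᵇ⇒≡ _ _ (proj₁ (Equivalence.to T-∧ tight)))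
    φq≡len : φ (label (index q)) ≡ len Γ (walk r)
    φq≡len = trans (cong φ (label-index q (last-present r ok)))
                   (trans (≡ᵇ⇒≡ _ _ (proj₂ (Equivalence.to T-∧ tight))) (sym (len-walk r)))

  Avoids : Subset M → List (Kind n) → Set
  Avoids Z ks = All (_∉ Z) (map index ks)

  outer-avoids : IsOuterGP Γ Z → index k ∈ Z →
    (φ : Kind n → ℕ) {lip : EveryEdge (LipschitzStep (present withX) φ)}
    (r : Route k q) {ok : RoutePresent r} {tight : T ((φ k ≡ᵇ 0) ∧ (φ q ≡ᵇ length r))} →
    All (_∉ Z) (inner Γ (walk r {ok}))
  outer-avoids O k∈Z φ {lip} r {ok} {tight} = outer⇒inner∉ Γ O k∈Z (walk r) (shortest φ {lip} r {ok} {tight})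

  dual-avoids : IsDualGP Γ Z → SameSide Γ Z (index k) (index q) →
    (φ : Kind n → ℕ) {lip : EveryEdge (LipschitzStep (present withX) φ)}
    (r : Route k q) {ok : RoutePresent r} {tight : T ((φ k ≡ᵇ 0) ∧ (φ q ≡ᵇ length r))} →
    All (_∉ Z) (inner Γ (walk r {ok}))
  dual-avoids D side φ {lip} r {ok} {tight} = dual⇒inner∉ Γ D side (walk r) (shortest φ {lip} r {ok} {tight})

  kindSet : (Kind n → Bool) → Subset M
  kindSet f = tabulate (f ∘ label)

  ⊆kindSet : ∀ f → (∀ k → Present k → T (f k) ⊎ index k ∉ Z) → Z ⊆ kindSet f
  ⊆kindSet {Z} f allowed {i} i∈Z with allowed (label i) (label-present i)
  ... | inj₁ fi = lookup⇒[]= i _ (trans (lookup∘tabulate _ i) (Equivalence.to T-≡ fi))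
  ... | inj₂ i∉Z = ⊥-elim (i∉Z (subst (_∈ Z) (sym (index-label i)) i∈Z))

  kindSet-total : ∀ f → (∀ k → Present k → T (f k) → PendantKind (present withX) k) → IsTotalGP Γ (kindSet f)
  kindSet-total f pendantKind = pendants-total Γ pendant
    where
    pendant : ∀ {i} → i ∈ kindSet f → Pendant Γ i
    pendant {i} i∈ {p} {q} e₁ e₂ = begin
      p                ≡⟨ sym (index-label p) ⟩
      index (label p)  ≡⟨ cong index (pendantKind (label i) (label-present i) fi (label-present p) (label-present q) e₁ e₂) ⟩
      index (label q)  ≡⟨ index-label q ⟩
      q                ∎
      where
      open ≡-Reasoning
      fi : T (f (label i))
      fi = Equivalence.from T-≡ (trans (sym (lookup∘tabulate _ i)) ([]=⇒lookup i∈))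

  block? : (B : Fin n → Kind n) (Z : Subset M) → (∃ λ j → index (B j) ∈ Z) ⊎ (∀ j → index (B j) ∉ Z)
  block? B Z with any? (λ j → index (B j) ∈? Z)
  ... | yes found = inj₁ found
  ... | no none = inj₂ λ j j∈Z → none (j , j∈Z)

  dual⇒a∉ : IsDualGP Γ Z → index a ∉ Z
  dual⇒a∉ {Z} D with sameSide? Γ Z (index (L o)) (index (X₁ o)) (index u)
  ... | inj₁ side = All.head (dual-avoids D side distL (La o ∷ aX₁ o ∷ []))
  ... | inj₂ (inj₁ side) = All.head (dual-avoids D side distL (La o ∷ au ∷ []))
  ... | inj₂ (inj₂ side) = All.head (dual-avoids D side distX₁ (X₁a o ∷ au ∷ []))

  dual⇒b∉ : IsDualGP Γ Z → index b ∉ Z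
  dual⇒b∉ {Z} D with sameSide? Γ Z (index (Y o)) (index (X₂ o)) (index w)
  ... | inj₁ side = All.head (dual-avoids D side distY (Yb o ∷ bX₂ o ∷ []))
  ... | inj₂ (inj₁ side) = All.head (dual-avoids D side distY (Yb o ∷ bw ∷ []))
  ... | inj₂ (inj₂ side) = All.head (dual-avoids D side distX₂ (X₂b o ∷ bw ∷ []))

  dual⇒hubs∉ : IsDualGP Γ Z → Avoids Z (a ∷ u ∷ v ∷ w ∷ b ∷ [])
  dual⇒hubs∉ D with dual-avoids D (inj₂ (dual⇒a∉ D , dual⇒b∉ D)) dista (au ∷ uv ∷ vw ∷ wb ∷ [])
  ... | u∉ ∷ v∉ ∷ w∉ ∷ [] = dual⇒a∉ D ∷ u∉ ∷ v∉ ∷ w∉ ∷ dual⇒b∉ D ∷ []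

  L∈outer⇒hubs∉ : IsOuterGP Γ Z → ∀ {i} → index (L i) ∈ Z → Avoids Z (a ∷ u ∷ v ∷ w ∷ b ∷ [])
  L∈outer⇒hubs∉ O {i} L∈Z = outer-avoids O L∈Z distL (La i ∷ au ∷ uv ∷ vw ∷ wb ∷ bY o ∷ [])

  Y∈outer⇒hubs∉ : IsOuterGP Γ Z → ∀ {i} → index (Y i) ∈ Z → Avoids Z (a ∷ u ∷ v ∷ w ∷ b ∷ [])
  Y∈outer⇒hubs∉ O {i} Y∈Z with outer-avoids O Y∈Z distY (Yb i ∷ bw ∷ wv ∷ vu ∷ ua ∷ aL o ∷ [])
  ... | b∉ ∷ w∉ ∷ v∉ ∷ u∉ ∷ a∉ ∷ [] = a∉ ∷ u∉ ∷ v∉ ∷ w∉ ∷ b∉ ∷ []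

module Gₙ {n : ℕ} (o : Fin n) (2≤n : 2 ≤ n) where
  open Indexing n
  open Labelled o true (kind n) index (λ i → present-true (kind n i)) (λ k _ → kind-index k) index-kind

  private variable
    Z : Subset (size n)
    i : Fin n

  L∪Y X₁∪w X₂∪u a∪b u∪v∪w∪x : Kind n → Bool
  L∪Y (L _) = true
  L∪Y (Y _) = true
  L∪Y _ = false
  X₁∪w (X₁ _) = true
  X₁∪w w = true
  X₁∪w _ = false
  X₂∪u (X₂ _) = true
  X₂∪u u = true
  X₂∪u _ = false
  a∪b a = true
  a∪b b = true
  a∪b _ = false
  u∪v∪w∪x u = true
  u∪v∪w∪x v = true
  u∪v∪w∪x w = true
  u∪v∪w∪x x = true
  u∪v∪w∪x _ = false

  L∪Y-total : IsTotalGP Γ (kindSet L∪Y)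
  L∪Y-total = kindSet-total L∪Y λ where
    (L _) _ _ → L-pendant ; (Y _) _ _ → Y-pendant
    a _ () ; u _ () ; v _ () ; w _ () ; b _ () ; x _ () ; (X₁ _) _ () ; (X₂ _) _ ()

  ∣L∪Y∣ : ∣ kindSet L∪Y ∣ ≡ 2 * n
  ∣L∪Y∣ = trans (∣blocks∣ L∪Y (λ _ → refl) (λ _ → refl) (λ _ → refl) (λ _ → refl)) (cong (n +_) (sym (+-identityʳ n)))

  ∣X₁∪w∣ : ∣ kindSet X₁∪w ∣ ≤ 2 * n
  ∣X₁∪w∣ = begin
    ∣ kindSet X₁∪w ∣ ≡⟨ cong suc (∣blocks∣ X₁∪w (λ _ → refl) (λ _ → refl) (λ _ → refl) (λ _ → refl)) ⟩
    1 + (n + 0)     ≤⟨ +-monoˡ-≤ (n + 0) (≤-trans (s≤s z≤n) 2≤n) ⟩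
    2 * n           ∎
    where open ≤-Reasoning

  ∣X₂∪u∣ : ∣ kindSet X₂∪u ∣ ≤ 2 * n
  ∣X₂∪u∣ = begin
    ∣ kindSet X₂∪u ∣ ≡⟨ cong suc (∣blocks∣ X₂∪u (λ _ → refl) (λ _ → refl) (λ _ → refl) (λ _ → refl)) ⟩
    1 + (0 + (n + 0)) ≤⟨ +-monoˡ-≤ (n + 0) (≤-trans (s≤s z≤n) 2≤n) ⟩
    2 * n           ∎
    where open ≤-Reasoning

  ∣a∪b∣ : ∣ kindSet a∪b ∣ ≤ 2 * n
  ∣a∪b∣ = begin
    ∣ kindSet a∪b ∣ ≡⟨ cong (2 +_) (∣blocks∣ a∪b (λ _ → refl) (λ _ → refl) (λ _ → refl) (λ _ → refl)) ⟩
    2 * 1           ≤⟨ *-monoʳ-≤ 2 (≤-trans (s≤s z≤n) 2≤n) ⟩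
    2 * n           ∎
    where open ≤-Reasoning

  ∣u∪v∪w∪x∣ : ∣ kindSet u∪v∪w∪x ∣ ≤ 2 * n
  ∣u∪v∪w∪x∣ = begin
    ∣ kindSet u∪v∪w∪x ∣ ≡⟨ cong (4 +_) (∣blocks∣ u∪v∪w∪x (λ _ → refl) (λ _ → refl) (λ _ → refl) (λ _ → refl)) ⟩
    2 * 2           ≤⟨ *-monoʳ-≤ 2 2≤n ⟩
    2 * n           ∎
    where open ≤-Reasoning

  ⊆L∪Y : Avoids Z (a ∷ u ∷ v ∷ w ∷ b ∷ []) → (∀ j → Avoids Z (X₁ j ∷ x ∷ X₂ j ∷ [])) → Z ⊆ kindSet L∪Y
  ⊆L∪Y (a∉ ∷ u∉ ∷ v∉ ∷ w∉ ∷ b∉ ∷ []) X-path∉ = ⊆kindSet L∪Y λ where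
    a _ → inj₂ a∉ ; u _ → inj₂ u∉ ; v _ → inj₂ v∉ ; w _ → inj₂ w∉ ; b _ → inj₂ b∉
    x _ → inj₂ (All.head (All.tail (X-path∉ o)))
    (X₁ j) _ → inj₂ (All.head (X-path∉ j))
    (X₂ j) _ → inj₂ (All.head (All.tail (All.tail (X-path∉ j))))
    (L _) _ → inj₁ tt ; (Y _) _ → inj₁ tt

  L∈outer⇒⊆L∪Y : IsOuterGP Γ Z → index (L i) ∈ Z → Z ⊆ kindSet L∪Y
  L∈outer⇒⊆L∪Y {Z} {i} O L∈Z = ⊆L∪Y (L∈outer⇒hubs∉ O L∈Z) X-path∉
    where
    X-path∉ : ∀ j → Avoids Z (X₁ j ∷ x ∷ X₂ j ∷ [])
    X-path∉ j with outer-avoids O L∈Z distL (La i ∷ aX₁ j ∷ X₁x j ∷ xX₂ j ∷ X₂b j ∷ bY o ∷ [])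
    ... | _ ∷ X₁∉ ∷ x∉ ∷ X₂∉ ∷ _ = X₁∉ ∷ x∉ ∷ X₂∉ ∷ []

  Y∈outer⇒⊆L∪Y : IsOuterGP Γ Z → index (Y i) ∈ Z → Z ⊆ kindSet L∪Y
  Y∈outer⇒⊆L∪Y {Z} {i} O Y∈Z = ⊆L∪Y (Y∈outer⇒hubs∉ O Y∈Z) X-path∉
    where
    X-path∉ : ∀ j → Avoids Z (X₁ j ∷ x ∷ X₂ j ∷ [])
    X-path∉ j with outer-avoids O Y∈Z distY (Yb i ∷ bX₂ j ∷ X₂x j ∷ xX₁ j ∷ X₁a j ∷ aL o ∷ [])
    ... | _ ∷ X₂∉ ∷ x∉ ∷ X₁∉ ∷ _ = X₁∉ ∷ x∉ ∷ X₂∉ ∷ []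

  X₁∈outer⇒⊆X₁∪w : IsOuterGP Γ Z → (∀ j → index (L j) ∉ Z) → (∀ j → index (Y j) ∉ Z) →
    index (X₁ i) ∈ Z → Z ⊆ kindSet X₁∪w
  X₁∈outer⇒⊆X₁∪w {Z} {i} O L∉ Y∉ X₁∈Z
    with outer-avoids O X₁∈Z distX₁ (X₁a i ∷ au ∷ uv ∷ vw ∷ [])
       | outer-avoids O X₁∈Z distX₁ (X₁x i ∷ xX₂ o ∷ X₂b o ∷ bw ∷ [])
  ... | a∉ ∷ u∉ ∷ v∉ ∷ [] | x∉ ∷ _ ∷ b∉ ∷ [] = ⊆kindSet X₁∪w λ where
      a _ → inj₂ a∉ ; u _ → inj₂ u∉ ; v _ → inj₂ v∉ ; w _ → inj₁ tt ; b _ → inj₂ b∉ ; x _ → inj₂ x∉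
      (X₁ _) _ → inj₁ tt ; (X₂ j) _ → inj₂ (X₂∉ j) ; (L j) _ → inj₂ (L∉ j) ; (Y j) _ → inj₂ (Y∉ j)
    where
    X₂∉ : ∀ j → index (X₂ j) ∉ Z
    X₂∉ j = All.head (All.tail (outer-avoids O X₁∈Z distX₁ (X₁x i ∷ xX₂ j ∷ X₂b j ∷ bw ∷ [])))

  X₂∈outer⇒⊆X₂∪u : IsOuterGP Γ Z → (∀ j → index (L j) ∉ Z) → (∀ j → index (Y j) ∉ Z) →
    (∀ j → index (X₁ j) ∉ Z) → index (X₂ i) ∈ Z → Z ⊆ kindSet X₂∪u
  X₂∈outer⇒⊆X₂∪u {Z} {i} O L∉ Y∉ X₁∉ X₂∈Z
    with outer-avoids O X₂∈Z distX₂ (X₂b i ∷ bw ∷ wv ∷ vu ∷ [])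
       | outer-avoids O X₂∈Z distX₂ (X₂x i ∷ xX₁ o ∷ X₁a o ∷ au ∷ [])
  ... | b∉ ∷ w∉ ∷ v∉ ∷ [] | x∉ ∷ _ ∷ a∉ ∷ [] = ⊆kindSet X₂∪u λ where
    a _ → inj₂ a∉ ; u _ → inj₁ tt ; v _ → inj₂ v∉ ; w _ → inj₂ w∉ ; b _ → inj₂ b∉ ; x _ → inj₂ x∉
    (X₁ j) _ → inj₂ (X₁∉ j) ; (X₂ _) _ → inj₁ tt ; (L j) _ → inj₂ (L∉ j) ; (Y j) _ → inj₂ (Y∉ j)

  a∈outer⇒uvwx∉ : IsOuterGP Γ Z → index a ∈ Z → Avoids Z (u ∷ v ∷ w ∷ x ∷ [])
  a∈outer⇒uvwx∉ O a∈Z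
    with outer-avoids O a∈Z dista (au ∷ uv ∷ vw ∷ wb ∷ [])
       | outer-avoids O a∈Z dista (aX₁ o ∷ X₁x o ∷ xX₂ o ∷ X₂b o ∷ [])
  ... | u∉ ∷ v∉ ∷ w∉ ∷ [] | _ ∷ x∉ ∷ _ = u∉ ∷ v∉ ∷ w∉ ∷ x∉ ∷ []

  b∈outer⇒uvwx∉ : IsOuterGP Γ Z → index b ∈ Z → Avoids Z (u ∷ v ∷ w ∷ x ∷ [])
  b∈outer⇒uvwx∉ O b∈Z
    with outer-avoids O b∈Z distb (bw ∷ wv ∷ vu ∷ ua ∷ [])
       | outer-avoids O b∈Z distb (bX₂ o ∷ X₂x o ∷ xX₁ o ∷ X₁a o ∷ [])
  ... | w∉ ∷ v∉ ∷ u∉ ∷ [] | _ ∷ x∉ ∷ _ = u∉ ∷ v∉ ∷ w∉ ∷ x∉ ∷ []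

  module _ (L∉ : ∀ j → index (L j) ∉ Z) (Y∉ : ∀ j → index (Y j) ∉ Z)
           (X₁∉ : ∀ j → index (X₁ j) ∉ Z) (X₂∉ : ∀ j → index (X₂ j) ∉ Z) where

    ⊆a∪b : Avoids Z (u ∷ v ∷ w ∷ x ∷ []) → Z ⊆ kindSet a∪b
    ⊆a∪b (u∉ ∷ v∉ ∷ w∉ ∷ x∉ ∷ []) = ⊆kindSet a∪b λ where
      a _ → inj₁ tt ; u _ → inj₂ u∉ ; v _ → inj₂ v∉ ; w _ → inj₂ w∉ ; b _ → inj₁ tt ; x _ → inj₂ x∉
      (X₁ j) _ → inj₂ (X₁∉ j) ; (X₂ j) _ → inj₂ (X₂∉ j) ; (L j) _ → inj₂ (L∉ j) ; (Y j) _ → inj₂ (Y∉ j)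

    ⊆u∪v∪w∪x : index a ∉ Z → index b ∉ Z → Z ⊆ kindSet u∪v∪w∪x
    ⊆u∪v∪w∪x a∉ b∉ = ⊆kindSet u∪v∪w∪x λ where
      a _ → inj₂ a∉ ; u _ → inj₁ tt ; v _ → inj₁ tt ; w _ → inj₁ tt ; b _ → inj₂ b∉ ; x _ → inj₁ tt
      (X₁ j) _ → inj₂ (X₁∉ j) ; (X₂ j) _ → inj₂ (X₂∉ j) ; (L j) _ → inj₂ (L∉ j) ; (Y j) _ → inj₂ (Y∉ j)

  outer-bound : IsOuterGP Γ Z → ∣ Z ∣ ≤ 2 * n
  outer-bound {Z} O with block? L Z
  ... | inj₁ (_ , L∈Z) = within (L∈outer⇒⊆L∪Y O L∈Z) (≤-reflexive ∣L∪Y∣)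
  ... | inj₂ L∉ with block? Y Z
  ...   | inj₁ (_ , Y∈Z) = within (Y∈outer⇒⊆L∪Y O Y∈Z) (≤-reflexive ∣L∪Y∣)
  ...   | inj₂ Y∉ with block? X₁ Z
  ...     | inj₁ (_ , X₁∈Z) = within (X₁∈outer⇒⊆X₁∪w O L∉ Y∉ X₁∈Z) ∣X₁∪w∣
  ...     | inj₂ X₁∉ with block? X₂ Z
  ...       | inj₁ (_ , X₂∈Z) = within (X₂∈outer⇒⊆X₂∪u O L∉ Y∉ X₁∉ X₂∈Z) ∣X₂∪u∣
  ...       | inj₂ X₂∉ with index a ∈? Z | index b ∈? Z
  ...         | yes a∈Z | _ = within (⊆a∪b L∉ Y∉ X₁∉ X₂∉ (a∈outer⇒uvwx∉ O a∈Z)) ∣a∪b∣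
  ...         | no _ | yes b∈Z = within (⊆a∪b L∉ Y∉ X₁∉ X₂∉ (b∈outer⇒uvwx∉ O b∈Z)) ∣a∪b∣
  ...         | no a∉Z | no b∉Z = within (⊆u∪v∪w∪x L∉ Y∉ X₁∉ X₂∉ a∉Z b∉Z) ∣u∪v∪w∪x∣

  dual-bound : IsDualGP Γ Z → ∣ Z ∣ ≤ 2 * n
  dual-bound {Z} D = within (⊆L∪Y (dual⇒hubs∉ D) X-path∉) (≤-reflexive ∣L∪Y∣)
    where
    X-path∉ : ∀ j → Avoids Z (X₁ j ∷ x ∷ X₂ j ∷ [])
    X-path∉ j = dual-avoids D (inj₂ (dual⇒a∉ D , dual⇒b∉ D)) dista (aX₁ j ∷ X₁x j ∷ xX₂ j ∷ X₂b j ∷ [])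

  gp-number : ∀ τ → ParamEq τ (G n) (2 * n)
  gp-number τ = (kindSet L∪Y , total⇒gp Γ τ L∪Y-total , ∣L∪Y∣) , upper-bound τ
    where
    upper-bound : ∀ τ Z → IsGP τ (G n) Z → ∣ Z ∣ ≤ 2 * n
    upper-bound outer _ = outer-bound
    upper-bound dual  _ = dual-bound
    upper-bound total _ = outer-bound ∘ total⇒gp Γ outer

module Gₙ-x {n : ℕ} (o : Fin n) (2≤n : 2 ≤ n) where
  open Indexing n using (kind-index; index-kind; ∣blocks∣) renaming (index to indexG)

  label : Fin (5 + (n + (n + (n + n)))) → Kind n
  label i = kind n (punchIn (xᵥ n) i)

  index : Kind n → Fin (5 + (n + (n + (n + n))))
  index a = zero
  index u = suc zero
  index v = suc (suc zero)
  index w = suc (suc (suc zero))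
  index b = suc (suc (suc (suc zero)))
  index x = zero  -- junk: x is not a vertex of G_n − x
  index (X₁ j) = 5 ↑ʳ (j ↑ˡ (n + (n + n)))
  index (X₂ j) = 5 ↑ʳ (n ↑ʳ (j ↑ˡ (n + n)))
  index (L j)  = 5 ↑ʳ (n ↑ʳ (n ↑ʳ (j ↑ˡ n)))
  index (Y j)  = 5 ↑ʳ (n ↑ʳ (n ↑ʳ (n ↑ʳ j)))

  punchIn-index : ∀ k → T (present false k) → punchIn (xᵥ n) (index k) ≡ indexG k
  punchIn-index a _ = refl
  punchIn-index u _ = refl
  punchIn-index v _ = refl
  punchIn-index w _ = refl
  punchIn-index b _ = refl
  punchIn-index (X₁ _) _ = refl
  punchIn-index (X₂ _) _ = refl
  punchIn-index (L _) _ = refl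
  punchIn-index (Y _) _ = refl

  label-index : ∀ k → T (present false k) → label (index k) ≡ k
  label-index k pk = trans (cong (kind n) (punchIn-index k pk)) (kind-index k)

  label-present : ∀ i → T (present false (label i))
  label-present i with label i in eq
  ... | x = ⊥-elim (punchInᵢ≢i (xᵥ n) i (trans (sym (index-kind _)) (cong indexG eq)))
  ... | a = tt
  ... | u = tt
  ... | v = tt
  ... | w = tt
  ... | b = tt
  ... | X₁ _ = tt
  ... | X₂ _ = tt
  ... | L _ = tt
  ... | Y _ = tt

  index-label : ∀ i → index (label i) ≡ i
  index-label i = punchIn-injective (xᵥ n) _ _ (trans (punchIn-index _ (label-present i)) (index-kind _))

  open Labelled o false label index label-present label-index index-label

  private variable
    Z : Subset (5 + (n + (n + (n + n))))
    i : Fin n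

  X₁∪X₂∪L∪Y a∪u∪v∪w∪b : Kind n → Bool
  X₁∪X₂∪L∪Y (X₁ _) = true
  X₁∪X₂∪L∪Y (X₂ _) = true
  X₁∪X₂∪L∪Y (L _) = true
  X₁∪X₂∪L∪Y (Y _) = true
  X₁∪X₂∪L∪Y _ = false
  a∪u∪v∪w∪b a = true
  a∪u∪v∪w∪b u = true
  a∪u∪v∪w∪b v = true
  a∪u∪v∪w∪b w = true
  a∪u∪v∪w∪b b = true
  a∪u∪v∪w∪b _ = false

  X₁∪X₂∪L∪Y-total : IsTotalGP Γ (kindSet X₁∪X₂∪L∪Y)
  X₁∪X₂∪L∪Y-total = kindSet-total X₁∪X₂∪L∪Y λ where
    (X₁ _) _ _ → X₁-pendant ; (X₂ _) _ _ → X₂-pendant ; (L _) _ _ → L-pendant ; (Y _) _ _ → Y-pendant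
    a _ () ; u _ () ; v _ () ; w _ () ; b _ () ; x () _

  ∣X₁∪X₂∪L∪Y∣ : ∣ kindSet X₁∪X₂∪L∪Y ∣ ≡ 4 * n
  ∣X₁∪X₂∪L∪Y∣ = trans (∣blocks∣ X₁∪X₂∪L∪Y (λ _ → refl) (λ _ → refl) (λ _ → refl) (λ _ → refl))
                      (cong (λ m → n + (n + (n + m))) (sym (+-identityʳ n)))

  ∣a∪u∪v∪w∪b∣ : ∣ kindSet a∪u∪v∪w∪b ∣ ≤ 4 * n
  ∣a∪u∪v∪w∪b∣ = begin
    ∣ kindSet a∪u∪v∪w∪b ∣ ≡⟨ cong (5 +_) (∣blocks∣ a∪u∪v∪w∪b (λ _ → refl) (λ _ → refl) (λ _ → refl) (λ _ → refl)) ⟩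
    5                     ≤⟨ m≤m+n 5 3 ⟩
    4 * 2                 ≤⟨ *-monoʳ-≤ 4 2≤n ⟩
    4 * n                 ∎
    where open ≤-Reasoning

  ⊆X₁∪X₂∪L∪Y : Avoids Z (a ∷ u ∷ v ∷ w ∷ b ∷ []) → Z ⊆ kindSet X₁∪X₂∪L∪Y
  ⊆X₁∪X₂∪L∪Y (a∉ ∷ u∉ ∷ v∉ ∷ w∉ ∷ b∉ ∷ []) = ⊆kindSet X₁∪X₂∪L∪Y λ where
    a _ → inj₂ a∉ ; u _ → inj₂ u∉ ; v _ → inj₂ v∉ ; w _ → inj₂ w∉ ; b _ → inj₂ b∉ ; x ()
    (X₁ _) _ → inj₁ tt ; (X₂ _) _ → inj₁ tt ; (L _) _ → inj₁ tt ; (Y _) _ → inj₁ tt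

  ⊆a∪u∪v∪w∪b : (∀ j → Avoids Z (X₁ j ∷ X₂ j ∷ L j ∷ Y j ∷ [])) → Z ⊆ kindSet a∪u∪v∪w∪b
  ⊆a∪u∪v∪w∪b blocks∉ = ⊆kindSet a∪u∪v∪w∪b λ where
    a _ → inj₁ tt ; u _ → inj₁ tt ; v _ → inj₁ tt ; w _ → inj₁ tt ; b _ → inj₁ tt ; x ()
    (X₁ j) _ → inj₂ (All.lookup (blocks∉ j) (here refl))
    (X₂ j) _ → inj₂ (All.lookup (blocks∉ j) (there (here refl)))
    (L j) _ → inj₂ (All.lookup (blocks∉ j) (there (there (here refl))))
    (Y j) _ → inj₂ (All.lookup (blocks∉ j) (there (there (there (here refl)))))

  X₁∈outer⇒hubs∉ : IsOuterGP Γ Z → index (X₁ i) ∈ Z → Avoids Z (a ∷ u ∷ v ∷ w ∷ b ∷ [])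
  X₁∈outer⇒hubs∉ {i = i} O X₁∈Z = outer-avoids O X₁∈Z distLeft (X₁a i ∷ au ∷ uv ∷ vw ∷ wb ∷ bY o ∷ [])

  X₂∈outer⇒hubs∉ : IsOuterGP Γ Z → index (X₂ i) ∈ Z → Avoids Z (a ∷ u ∷ v ∷ w ∷ b ∷ [])
  X₂∈outer⇒hubs∉ {i = i} O X₂∈Z with outer-avoids O X₂∈Z distRight (X₂b i ∷ bw ∷ wv ∷ vu ∷ ua ∷ aL o ∷ [])
  ... | b∉ ∷ w∉ ∷ v∉ ∷ u∉ ∷ a∉ ∷ [] = a∉ ∷ u∉ ∷ v∉ ∷ w∉ ∷ b∉ ∷ []

  outer-bound : IsOuterGP Γ Z → ∣ Z ∣ ≤ 4 * n
  outer-bound {Z} O with block? X₁ Z | block? X₂ Z | block? L Z | block? Y Z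
  ... | inj₁ (_ , X₁∈Z) | _ | _ | _ = within (⊆X₁∪X₂∪L∪Y (X₁∈outer⇒hubs∉ O X₁∈Z)) (≤-reflexive ∣X₁∪X₂∪L∪Y∣)
  ... | _ | inj₁ (_ , X₂∈Z) | _ | _ = within (⊆X₁∪X₂∪L∪Y (X₂∈outer⇒hubs∉ O X₂∈Z)) (≤-reflexive ∣X₁∪X₂∪L∪Y∣)
  ... | _ | _ | inj₁ (_ , L∈Z) | _ = within (⊆X₁∪X₂∪L∪Y (L∈outer⇒hubs∉ O L∈Z)) (≤-reflexive ∣X₁∪X₂∪L∪Y∣)
  ... | _ | _ | _ | inj₁ (_ , Y∈Z) = within (⊆X₁∪X₂∪L∪Y (Y∈outer⇒hubs∉ O Y∈Z)) (≤-reflexive ∣X₁∪X₂∪L∪Y∣)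
  ... | inj₂ X₁∉ | inj₂ X₂∉ | inj₂ L∉ | inj₂ Y∉ =
    within (⊆a∪u∪v∪w∪b λ j → X₁∉ j ∷ X₂∉ j ∷ L∉ j ∷ Y∉ j ∷ []) ∣a∪u∪v∪w∪b∣

  dual-bound : IsDualGP Γ Z → ∣ Z ∣ ≤ 4 * n
  dual-bound D = within (⊆X₁∪X₂∪L∪Y (dual⇒hubs∉ D)) (≤-reflexive ∣X₁∪X₂∪L∪Y∣)

  gp-number : ∀ τ → ParamEq τ (G-x n) (4 * n)
  gp-number τ = (kindSet X₁∪X₂∪L∪Y , total⇒gp Γ τ X₁∪X₂∪L∪Y-total , ∣X₁∪X₂∪L∪Y∣) , upper-bound τ
    where
    upper-bound : ∀ τ Z → IsGP τ (G-x n) Z → ∣ Z ∣ ≤ 4 * n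
    upper-bound outer _ = outer-bound
    upper-bound dual  _ = dual-bound
    upper-bound total _ = outer-bound ∘ total⇒gp Γ outer

proposition3p1 : (n : ℕ) → 2 ≤ n → (τ : GPKind) →
    ParamEq τ (G n) (2 * n) × ParamEq τ (G-x n) (4 * n)
proposition3p1 (suc _) 2≤n τ = Gₙ.gp-number zero 2≤n τ , Gₙ-x.gp-number zero 2≤n τ
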